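{- Let $n\ge 5$. For every integer $k$ with $1\le k\le\lfloor\frac{n-1}{2}\rfloor$ there exists a Latin square of order $n$ with inner distance $k$. Moreover, for any Latin square $L$ of order $n$ with inner distance $k$ and any $k'$ with $1\le k'<k$, there is a bijection $\sigma$ of $[1,n]$ such that $\sigma(L)$ has inner distance $k'$.
   Context: A Latin square of order $n$ is an $n\times n$ matrix with entries $m_{i,j}\in[1,n]$ such that every row and column contains each symbol exactly once; $\sigma(L)$ has entries $\sigma(m_{i,j})$. Cells are adjacent if they share a horizontal or vertical edge. $\mathrm{dist}(a,b)$ is the minimum of the residues in $[0,n-1]$ of $a-b$ and $b-a$ modulo $n$. The inner distance of a Latin square is the minimum of $\mathrm{dist}$ over all pairs of symbols in adjacent cells. -}

module Defs where

open import Data.Nat using (ℕ; suc; _+_; _∸_; _≤_; _⊓_; NonZero)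
open import Data.Nat.DivMod using (_%_)
open import Data.Fin using (Fin; toℕ; suc; zero; inject₁)
open import Data.Product using (_×_; ∃; ∃-syntax; _,_)
open import Data.Sum using (_⊎_)
open import Relation.Binary.PropositionalEquality using (_≡_)
open import Function.Definitions using (Bijective)
open import Function.Bundles using (_⤖_; Bijection)

-- Symbols [1,n] are represented by Fin n (symbol s ↦ s - 1); the cyclic
-- distance is invariant under this shift.

Matrix : ℕ → Set
Matrix n = Fin n → Fin n → Fin n

IsLatinSquare : (n : ℕ) → Matrix n → Set
IsLatinSquare n L =
  ((i : Fin n) → Bijective _≡_ _≡_ (λ j → L i j)) ×
  ((j : Fin n) → Bijective _≡_ _≡_ (λ i → L i j))

-- residue in [0,n-1] of a - b mod n  (for a b < n)
resMod : (n : ℕ) → .{{NonZero n}} → ℕ → ℕ → ℕ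
resMod n a b = (a + n ∸ b) % n

dist : (n : ℕ) → .{{NonZero n}} → Fin n → Fin n → ℕ
dist n a b = resMod n (toℕ a) (toℕ b) ⊓ resMod n (toℕ b) (toℕ a)

Adjacent : {n : ℕ} → Fin n → Fin n → Fin n → Fin n → Set
Adjacent i j i' j' =
  (i ≡ i' × (toℕ j' ≡ suc (toℕ j) ⊎ toℕ j ≡ suc (toℕ j'))) ⊎
  (j ≡ j' × (toℕ i' ≡ suc (toℕ i) ⊎ toℕ i ≡ suc (toℕ i')))

-- Inner distance of L equals k: k is the minimum of dist over adjacent pairs
-- (k is a lower bound and is attained).
HasInnerDistance : (n : ℕ) → .{{NonZero n}} → Matrix n → ℕ → Set
HasInnerDistance n L k =
  ((i j i' j' : Fin n) → Adjacent i j i' j' → k ≤ dist n (L i j) (L i' j')) ×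
  ∃[ i ] ∃[ j ] ∃[ i' ] ∃[ j' ] (Adjacent i j i' j' × dist n (L i j) (L i' j') ≡ k)

applySym : {n : ℕ} → (Fin n → Fin n) → Matrix n → Matrix n
applySym σ L i j = σ (L i j)

-- Symbols are residues mod n, and for symbols at integer gap d the cyclic distance is
-- min(d, n − d); it is invariant under translation.
--
-- With m = ⌊(n−1)/2⌋, list the residues in the zigzag order 0, m+1, 1, m+2, 2, …,
-- whose consecutive terms differ by m or m+1, and let Z be the resulting permutation.  The sum
-- square L(i,j) = Z(i) + Z(j) mod n is Latin, and by translation invariance two adjacent cells
-- are at the distance of two consecutive zigzag terms, so its inner distance is exactly m.
-- Smaller values are then reached by relabelling.
--
-- Let the inner distance be k+1 ≥ 2, attained at adjacent symbols a and b.  One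
-- of them, say b, has an integer neighbour c (|b − c| = 1) at cyclic distance k from a.  The
-- transposition (b c) moves every symbol by at most one, and cannot move both symbols of a pair
-- at distance ≥ 2, so no adjacent pair drops below k, while the pair (a, b) becomes (a, c) at
-- distance k.  Iterating reaches every k' < k.

{-# OPTIONS --safe #-}
module Submission where

open import Defs
open import Data.Nat using (ℕ; zero; suc; pred; _+_; _*_; _∸_; _≤_; _<_; _⊓_; _/_; z≤n; s≤s; NonZero; ∣_-_∣)
open import Data.Nat.Properties hiding (_≟_)
open import Data.Nat.DivMod
  using (_%_; _mod_; m≡m%n+[m/n]*n; /-monoˡ-≤; m%n<n; m%n≤n; m<n⇒m%n≡m; [m+n]%n≡m%n; %-distribˡ-+; m%n%n≡m%n)
open import Data.Nat.Tactic.RingSolver using (solve-∀)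
open import Data.Fin using (Fin; toℕ; fromℕ<)
open import Data.Fin.Properties using (_≟_; toℕ<n; toℕ-injective; toℕ-fromℕ<)
open import Data.Fin.Permutation using (Permutation′; permutation; transpose; _⟨$⟩ʳ_; _∘ₚ_)
import Data.Fin.Permutation.Components as PC
open import Data.Product using (Σ; Σ-syntax; _×_; ∃-syntax; _,_)
open import Data.Sum using (_⊎_; inj₁; inj₂; swap) renaming (map to ⊎-map)
open import Function.Bundles using (_⤖_; Bijection)
open import Function.Definitions using (Bijective)
open import Function.Properties.Inverse using (↔⇒⤖)
import Function.Construct.Composition as Comp
open import Relation.Binary.PropositionalEquality
open import Relation.Binary.Definitions using (tri<; tri≈; tri>)
open import Relation.Nullary using (yes; no; contradiction)
open import Relation.Nullary.Decidable using (dec-true; dec-false)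

[m%n+o]%n≡[m+o]%n : ∀ m o n .{{_ : NonZero n}} → (m % n + o) % n ≡ (m + o) % n
[m%n+o]%n≡[m+o]%n m o n = begin
  (m % n + o) % n          ≡⟨ %-distribˡ-+ (m % n) o n ⟩
  (m % n % n + o % n) % n  ≡⟨ cong (λ x → (x + o % n) % n) (m%n%n≡m%n m n) ⟩
  (m % n + o % n) % n      ≡⟨ %-distribˡ-+ m o n ⟨
  (m + o) % n              ∎
  where open ≡-Reasoning

[m+o%n]%n≡[m+o]%n : ∀ m o n .{{_ : NonZero n}} → (m + o % n) % n ≡ (m + o) % n
[m+o%n]%n≡[m+o]%n m o n = begin
  (m + o % n) % n  ≡⟨ cong (_% n) (+-comm m (o % n)) ⟩
  (o % n + m) % n  ≡⟨ [m%n+o]%n≡[m+o]%n o m n ⟩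
  (o + m) % n      ≡⟨ cong (_% n) (+-comm o m) ⟩
  (m + o) % n      ∎
  where open ≡-Reasoning

even-or-odd : ∀ x → ∃[ t ] (x ≡ t + t ⊎ x ≡ suc (t + t))
even-or-odd zero = 0 , inj₁ refl
even-or-odd (suc x) with even-or-odd x
... | t , inj₁ refl = t , inj₂ refl
... | t , inj₂ refl = suc t , inj₁ (cong suc (sym (+-suc t t)))

half-< : ∀ {t u} → t + t < u + u → t < u
half-< {t} {u} t+t<u+u with t <? u
... | yes t<u = t<u
... | no t≮u  = contradiction t+t<u+u (≤⇒≯ (+-mono-≤ (≮⇒≥ t≮u) (≮⇒≥ t≮u)))

r+m*2≡m+[m+r] : ∀ r m → r + m * 2 ≡ m + (m + r)
r+m*2≡m+[m+r] = solve-∀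

split-halves : ∀ p → ∃[ q ] (p ≡ p / 2 + q × p / 2 ≤ q × q ≤ suc (p / 2))
split-halves p =
  p / 2 + p % 2 ,
  trans (m≡m%n+[m/n]*n p 2) (r+m*2≡m+[m+r] (p % 2) (p / 2)) ,
  m≤m+n (p / 2) (p % 2) ,
  ≤-trans (+-monoʳ-≤ (p / 2) (≤-pred (m%n<n p 2))) (≤-reflexive (+-comm (p / 2) 1))

∣1+m-m∣≡1 : ∀ m → ∣ suc m - m ∣ ≡ 1
∣1+m-m∣≡1 zero    = refl
∣1+m-m∣≡1 (suc m) = ∣1+m-m∣≡1 m

∣m-1+m∣≡1 : ∀ m → ∣ m - suc m ∣ ≡ 1
∣m-1+m∣≡1 m = trans (∣-∣-comm m (suc m)) (∣1+m-m∣≡1 m)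

module _ {n : ℕ} where

  transpose-matchˡ : ∀ (i j : Fin n) → PC.transpose i j i ≡ j
  transpose-matchˡ i j rewrite dec-true (i ≟ i) refl = refl

  transpose-matchʳ : ∀ (i j : Fin n) → PC.transpose i j j ≡ i
  transpose-matchʳ i j with j ≟ i
  ... | yes refl = refl
  ... | no _ rewrite dec-true (j ≟ j) refl = refl

  transpose-cases : ∀ (i j k : Fin n) → (k ≡ i ⊎ k ≡ j) ⊎ PC.transpose i j k ≡ k
  transpose-cases i j k with k ≟ i
  ... | yes k≡i = inj₁ (inj₁ k≡i)
  ... | no _ with k ≟ j
  ...   | yes k≡j = inj₁ (inj₂ k≡j)
  ...   | no _    = inj₂ refl

  transpose-fixes : ∀ {i j k : Fin n} → k ≢ i → k ≢ j → PC.transpose i j k ≡ k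
  transpose-fixes {i} {j} {k} k≢i k≢j rewrite dec-false (k ≟ i) k≢i | dec-false (k ≟ j) k≢j = refl

  transpose-displacement : ∀ {i j : Fin n} → ∣ toℕ i - toℕ j ∣ ≤ 1 →
                           ∀ k → ∣ toℕ (PC.transpose i j k) - toℕ k ∣ ≤ 1
  transpose-displacement {i} {j} i≈j k with transpose-cases i j k
  ... | inj₁ (inj₁ refl) rewrite transpose-matchˡ k j = subst (_≤ 1) (∣-∣-comm (toℕ k) (toℕ j)) i≈j
  ... | inj₁ (inj₂ refl) rewrite transpose-matchʳ i k = i≈j
  ... | inj₂ fixed       rewrite fixed = subst (_≤ 1) (sym (∣n-n∣≡0 (toℕ k))) z≤n

  ∣-∣≤1-within : ∀ {i j x y : Fin n} → ∣ toℕ i - toℕ j ∣ ≤ 1 →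
                 x ≡ i ⊎ x ≡ j → y ≡ i ⊎ y ≡ j → ∣ toℕ x - toℕ y ∣ ≤ 1
  ∣-∣≤1-within {x = x} _   (inj₁ refl) (inj₁ refl) = subst (_≤ 1) (sym (∣n-n∣≡0 (toℕ x))) z≤n
  ∣-∣≤1-within         i≈j (inj₁ refl) (inj₂ refl) = i≈j
  ∣-∣≤1-within {i} {j} i≈j (inj₂ refl) (inj₁ refl) = subst (_≤ 1) (∣-∣-comm (toℕ i) (toℕ j)) i≈j
  ∣-∣≤1-within {x = x} _   (inj₂ refl) (inj₂ refl) = subst (_≤ 1) (sym (∣n-n∣≡0 (toℕ x))) z≤n

  Adjacent-sym : ∀ {i j i' j' : Fin n} → Adjacent i j i' j' → Adjacent i' j' i j
  Adjacent-sym (inj₁ (refl , side)) = inj₁ (refl , swap side)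
  Adjacent-sym (inj₂ (refl , side)) = inj₂ (refl , swap side)

  ⟨$⟩ʳ-bijective : (π : Permutation′ n) → Bijective _≡_ _≡_ (π ⟨$⟩ʳ_)
  ⟨$⟩ʳ-bijective π = Bijection.bijective (↔⇒⤖ π)

  applySym-isLatinSquare : ∀ (π : Permutation′ n) {L} → IsLatinSquare n L → IsLatinSquare n (applySym (π ⟨$⟩ʳ_) L)
  applySym-isLatinSquare π (rows , columns) =
    (λ i → Comp.bijective _≡_ _≡_ _≡_ (rows i) (⟨$⟩ʳ-bijective π)) ,
    (λ j → Comp.bijective _≡_ _≡_ _≡_ (columns j) (⟨$⟩ʳ-bijective π))

module CyclicDistance (n : ℕ) .{{_ : NonZero n}} where

  resMod-+% : ∀ {r b} → r < n → b ≤ n → resMod n ((r + b) % n) b ≡ r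
  resMod-+% {r} {b} r<n b≤n = begin
    ((r + b) % n + n ∸ b) % n    ≡⟨ cong (_% n) (+-∸-assoc ((r + b) % n) b≤n) ⟩
    ((r + b) % n + (n ∸ b)) % n  ≡⟨ [m%n+o]%n≡[m+o]%n (r + b) (n ∸ b) n ⟩
    (r + b + (n ∸ b)) % n        ≡⟨ cong (_% n) (trans (+-assoc r b (n ∸ b)) (cong (r +_) (m+[n∸m]≡n b≤n))) ⟩
    (r + n) % n                  ≡⟨ [m+n]%n≡m%n r n ⟩
    r % n                        ≡⟨ m<n⇒m%n≡m r<n ⟩
    r                            ∎
    where open ≡-Reasoning

  [resMod+b]%n≡a : ∀ {a b} → a < n → b ≤ n → (resMod n a b + b) % n ≡ a
  [resMod+b]%n≡a {a} {b} a<n b≤n = begin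
    ((a + n ∸ b) % n + b) % n  ≡⟨ [m%n+o]%n≡[m+o]%n (a + n ∸ b) b n ⟩
    (a + n ∸ b + b) % n        ≡⟨ cong (_% n) (m∸n+n≡m (≤-trans b≤n (m≤n+m n a))) ⟩
    (a + n) % n                ≡⟨ [m+n]%n≡m%n a n ⟩
    a % n                      ≡⟨ m<n⇒m%n≡m a<n ⟩
    a                          ∎
    where open ≡-Reasoning

  resMod-translate : ∀ c {a b} → a < n → b < n → resMod n ((c + a) % n) ((c + b) % n) ≡ resMod n a b
  resMod-translate c {a} {b} a<n b<n = begin
    resMod n ((c + a) % n) ((c + b) % n)          ≡⟨ cong (λ x → resMod n x ((c + b) % n)) c+a≡r+[c+b] ⟩
    resMod n ((r + (c + b) % n) % n) ((c + b) % n) ≡⟨ resMod-+% (m%n<n (a + n ∸ b) n) (m%n≤n (c + b) n) ⟩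
    r                                              ∎
    where
    open ≡-Reasoning
    r = resMod n a b
    c+a≡r+[c+b] : (c + a) % n ≡ (r + (c + b) % n) % n
    c+a≡r+[c+b] = begin
      (c + a) % n            ≡⟨ cong (λ x → (c + x) % n) ([resMod+b]%n≡a a<n (<⇒≤ b<n)) ⟨
      (c + (r + b) % n) % n  ≡⟨ [m+o%n]%n≡[m+o]%n c (r + b) n ⟩
      (c + (r + b)) % n      ≡⟨ cong (_% n) (trans (sym (+-assoc c r b)) (trans (cong (_+ b) (+-comm c r)) (+-assoc r c b))) ⟩
      (r + (c + b)) % n      ≡⟨ [m+o%n]%n≡[m+o]%n r (c + b) n ⟨
      (r + (c + b) % n) % n  ∎
      where open ≡-Reasoning

  arc : ℕ → ℕ
  arc d = d ⊓ (n ∸ d)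

  resMod-+ˡ : ∀ b {d} → d < n → resMod n (b + d) b ≡ d
  resMod-+ˡ b {d} d<n = begin
    (b + d + n ∸ b) % n  ≡⟨ cong (_% n) (trans (cong (_∸ b) (+-assoc b d n)) (m+n∸m≡n b (d + n))) ⟩
    (d + n) % n          ≡⟨ [m+n]%n≡m%n d n ⟩
    d % n                ≡⟨ m<n⇒m%n≡m d<n ⟩
    d                    ∎
    where open ≡-Reasoning

  resMod-+ʳ : ∀ b {d} → d < n → resMod n b (b + d) ≡ (n ∸ d) % n
  resMod-+ʳ b {d} _ = cong (_% n) ([m+n]∸[m+o]≡n∸o b n d)

  -- For d = 0 the second residue is n % n = 0, not n, but the minimum is 0 either way.
  resMod-⊓-+ : ∀ b {d} → d < n → resMod n (b + d) b ⊓ resMod n b (b + d) ≡ arc d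
  resMod-⊓-+ b {zero} d<n rewrite resMod-+ˡ b d<n = refl
  resMod-⊓-+ b {suc d} d<n rewrite resMod-+ˡ b d<n | resMod-+ʳ b d<n =
    cong (suc d ⊓_) (m<n⇒m%n≡m (∸-monoʳ-< (s≤s z≤n) (<⇒≤ d<n)))

  resMod-⊓ : ∀ {a b} → a < n → b < n → resMod n a b ⊓ resMod n b a ≡ arc ∣ a - b ∣
  resMod-⊓ {a} {b} a<n b<n with ≤-total b a
  ... | inj₁ b≤a with d , refl ← m≤n⇒∃[o]m+o≡n b≤a =
    trans (resMod-⊓-+ b (≤-<-trans (m≤n+m d b) a<n)) (cong arc (sym (trans (∣-∣-comm (b + d) b) (∣m-m+n∣≡n b d))))
  ... | inj₂ a≤b with d , refl ← m≤n⇒∃[o]m+o≡n a≤b =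
    trans (⊓-comm _ _) (trans (resMod-⊓-+ a (≤-<-trans (m≤n+m d a) b<n)) (cong arc (sym (∣m-m+n∣≡n a d))))

  dist≡arc : ∀ (x y : Fin n) → dist n x y ≡ arc ∣ toℕ x - toℕ y ∣
  dist≡arc x y = resMod-⊓ (toℕ<n x) (toℕ<n y)

  arc-pred : ∀ {k} p x y → ∣ p - x ∣ ≤ 1 → suc k ≤ arc ∣ x - y ∣ → k ≤ arc ∣ p - y ∣
  arc-pred {k} p x y p≈x k<arc = ⊓-glb k≤∣p-y∣ k≤n∸∣p-y∣
    where
    k<∣x-y∣ : suc k ≤ ∣ x - y ∣
    k<∣x-y∣ = ≤-trans k<arc (m⊓n≤m _ _)
    k<n∸∣x-y∣ : suc k ≤ n ∸ ∣ x - y ∣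
    k<n∸∣x-y∣ = ≤-trans k<arc (m⊓n≤n _ _)
    k≤∣p-y∣ : k ≤ ∣ p - y ∣
    k≤∣p-y∣ = ≤-pred (begin
      suc k                ≤⟨ k<∣x-y∣ ⟩
      ∣ x - y ∣            ≤⟨ ∣-∣-triangle x p y ⟩
      ∣ x - p ∣ + ∣ p - y ∣ ≤⟨ +-monoˡ-≤ ∣ p - y ∣ (subst (_≤ 1) (∣-∣-comm p x) p≈x) ⟩
      suc ∣ p - y ∣        ∎)
      where open ≤-Reasoning
    k≤n∸∣p-y∣ : k ≤ n ∸ ∣ p - y ∣
    k≤n∸∣p-y∣ = begin
      k                    ≤⟨ pred-mono-≤ k<n∸∣x-y∣ ⟩
      pred (n ∸ ∣ x - y ∣) ≡⟨ pred[m∸n]≡m∸[1+n] n ∣ x - y ∣ ⟩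
      n ∸ suc ∣ x - y ∣    ≤⟨ ∸-monoʳ-≤ n (≤-trans (∣-∣-triangle p x y) (+-monoˡ-≤ ∣ x - y ∣ p≈x)) ⟩
      n ∸ ∣ p - y ∣        ∎
      where open ≤-Reasoning

  dist-comm : ∀ x y → dist n x y ≡ dist n y x
  dist-comm x y = ⊓-comm _ _

  dist-self : ∀ x → dist n x x ≡ 0
  dist-self x = trans (dist≡arc x x) (cong arc (∣n-n∣≡0 (toℕ x)))

  dist≤∣-∣ : ∀ x y → dist n x y ≤ ∣ toℕ x - toℕ y ∣
  dist≤∣-∣ x y = subst (_≤ ∣ toℕ x - toℕ y ∣) (sym (dist≡arc x y)) (m⊓n≤m _ _)

  dist>0⇒≢ : ∀ {x y} → 0 < dist n x y → x ≢ y
  dist>0⇒≢ {x} pos refl = <-irrefl (sym (dist-self x)) pos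

  dist-predˡ : ∀ {k} p x y → ∣ toℕ p - toℕ x ∣ ≤ 1 → suc k ≤ dist n x y → k ≤ dist n p y
  dist-predˡ p x y p≈x k<d rewrite dist≡arc p y | dist≡arc x y = arc-pred (toℕ p) (toℕ x) (toℕ y) p≈x k<d

  dist-predʳ : ∀ {k} x p y → ∣ toℕ p - toℕ y ∣ ≤ 1 → suc k ≤ dist n x y → k ≤ dist n x p
  dist-predʳ x p y p≈y k<d rewrite dist-comm x p | dist-comm x y = dist-predˡ p y x p≈y k<d

  infixl 6 _⊕_ _⊖_

  _⊕_ : Fin n → Fin n → Fin n
  x ⊕ y = (toℕ x + toℕ y) mod n

  _⊖_ : Fin n → Fin n → Fin n
  y ⊖ x = (toℕ y + n ∸ toℕ x) mod n

  toℕ-⊕ : ∀ x y → toℕ (x ⊕ y) ≡ (toℕ x + toℕ y) % n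
  toℕ-⊕ x y = toℕ-fromℕ< (m%n<n (toℕ x + toℕ y) n)

  toℕ-⊖ : ∀ y x → toℕ (y ⊖ x) ≡ resMod n (toℕ y) (toℕ x)
  toℕ-⊖ y x = toℕ-fromℕ< (m%n<n (toℕ y + n ∸ toℕ x) n)

  ⊕-comm : ∀ x y → x ⊕ y ≡ y ⊕ x
  ⊕-comm x y = toℕ-injective (begin
    toℕ (x ⊕ y)            ≡⟨ toℕ-⊕ x y ⟩
    (toℕ x + toℕ y) % n    ≡⟨ cong (_% n) (+-comm (toℕ x) (toℕ y)) ⟩
    (toℕ y + toℕ x) % n    ≡⟨ toℕ-⊕ y x ⟨
    toℕ (y ⊕ x)            ∎)
    where open ≡-Reasoning

  ⊖-⊕ : ∀ c y → (y ⊖ c) ⊕ c ≡ y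
  ⊖-⊕ c y = toℕ-injective (begin
    toℕ ((y ⊖ c) ⊕ c)                       ≡⟨ toℕ-⊕ (y ⊖ c) c ⟩
    (toℕ (y ⊖ c) + toℕ c) % n               ≡⟨ cong (λ r → (r + toℕ c) % n) (toℕ-⊖ y c) ⟩
    (resMod n (toℕ y) (toℕ c) + toℕ c) % n  ≡⟨ [resMod+b]%n≡a (toℕ<n y) (<⇒≤ (toℕ<n c)) ⟩
    toℕ y                                   ∎)
    where open ≡-Reasoning

  ⊕-⊖ : ∀ c x → (x ⊕ c) ⊖ c ≡ x
  ⊕-⊖ c x = toℕ-injective (begin
    toℕ ((x ⊕ c) ⊖ c)                      ≡⟨ toℕ-⊖ (x ⊕ c) c ⟩
    resMod n (toℕ (x ⊕ c)) (toℕ c)         ≡⟨ cong (λ a → resMod n a (toℕ c)) (toℕ-⊕ x c) ⟩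
    resMod n ((toℕ x + toℕ c) % n) (toℕ c) ≡⟨ resMod-+% (toℕ<n x) (<⇒≤ (toℕ<n c)) ⟩
    toℕ x                                  ∎)
    where open ≡-Reasoning

  translationʳ : Fin n → Permutation′ n
  translationʳ c = permutation (_⊕ c) (_⊖ c) (⊖-⊕ c) (⊕-⊖ c)

  translationˡ : Fin n → Permutation′ n
  translationˡ c = permutation (c ⊕_) (_⊖ c)
    (λ y → trans (⊕-comm c (y ⊖ c)) (⊖-⊕ c y))
    (λ x → trans (cong (_⊖ c) (⊕-comm c x)) (⊕-⊖ c x))

  dist-translate : ∀ c x y → dist n (c ⊕ x) (c ⊕ y) ≡ dist n x y
  dist-translate c x y = begin
    dist n (c ⊕ x) (c ⊕ y)
      ≡⟨ cong₂ (λ a b → resMod n a b ⊓ resMod n b a) (toℕ-⊕ c x) (toℕ-⊕ c y) ⟩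
    resMod n ((toℕ c + toℕ x) % n) ((toℕ c + toℕ y) % n) ⊓ resMod n ((toℕ c + toℕ y) % n) ((toℕ c + toℕ x) % n)
      ≡⟨ cong₂ _⊓_ (resMod-translate (toℕ c) (toℕ<n x) (toℕ<n y)) (resMod-translate (toℕ c) (toℕ<n y) (toℕ<n x)) ⟩
    dist n x y
      ∎
    where open ≡-Reasoning

  dist-translateʳ : ∀ c x y → dist n (x ⊕ c) (y ⊕ c) ≡ dist n x y
  dist-translateʳ c x y = trans (cong₂ (dist n) (⊕-comm x c) (⊕-comm y c)) (dist-translate c x y)

module Relabel (n : ℕ) .{{_ : NonZero n}} where

  open CyclicDistance n

  transpose-lowers : ∀ {k} {w c : Fin n} → ∣ toℕ w - toℕ c ∣ ≤ 1 → ∀ x y →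
                     suc k ≤ dist n x y → k ≤ dist n (PC.transpose w c x) (PC.transpose w c y)
  transpose-lowers {w = w} {c} w≈c x y k<d with transpose-cases w c x | transpose-cases w c y
  ... | inj₂ fixed | _ rewrite fixed = dist-predʳ x _ y (transpose-displacement w≈c y) k<d
  ... | inj₁ _ | inj₂ fixed rewrite fixed = dist-predˡ _ x y (transpose-displacement w≈c x) k<d
  ... | inj₁ x∈ | inj₁ y∈ =
    ≤-trans (≤-pred (≤-trans k<d (≤-trans (dist≤∣-∣ x y) (∣-∣≤1-within w≈c x∈ y∈)))) z≤n

  CloserNeighbourℕ : ℕ → ℕ → ℕ → Set
  CloserNeighbourℕ a b k = Σ[ c ∈ ℕ ] c < n × ∣ b - c ∣ ≡ 1 × arc ∣ a - c ∣ ≡ k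

  arc-shortened : ∀ {d k} → n ∸ d ≤ d → n ∸ d ≡ suc (suc k) → arc (suc d) ≡ suc k
  arc-shortened {d} {k} long n∸d≡ = trans (m≥n⇒m⊓n≡n (≤-trans (≤-reflexive n∸1+d≡) k<d)) n∸1+d≡
    where
    n∸1+d≡ : n ∸ suc d ≡ suc k
    n∸1+d≡ = trans (sym (pred[m∸n]≡m∸[1+n] n d)) (cong pred n∸d≡)
    k<d : suc k ≤ suc d
    k<d = ≤-trans (n≤1+n (suc k)) (≤-trans (≤-reflexive (sym n∸d≡)) (≤-trans long (n≤1+n d)))

  closer-neighbourℕ : ∀ {a b k} → a < b → b < n → arc ∣ a - b ∣ ≡ suc (suc k) →
                      CloserNeighbourℕ a b (suc k) ⊎ CloserNeighbourℕ b a (suc k)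
  closer-neighbourℕ {a} {b} {k} a<b b<n arc≡ with d , refl ← m≤n⇒∃[o]m+o≡n (<⇒≤ a<b)
    rewrite ∣m-m+n∣≡n a d with ≤-total d (n ∸ d)
  ... | inj₁ short with refl ← trans (sym (m≤n⇒m⊓n≡m short)) arc≡ =
    inj₁ (a + suc k , ≤-<-trans (+-monoʳ-≤ a (n≤1+n (suc k))) b<n ,
          trans (∣m+n-m+o∣≡∣n-o∣ a (suc (suc k)) (suc k)) (∣1+m-m∣≡1 k) ,
          trans (cong arc (∣m-m+n∣≡n a (suc k))) (m≤n⇒m⊓n≡m k<n∸k))
    where
    k<n∸k : suc k ≤ n ∸ suc k
    k<n∸k = ≤-trans (n≤1+n (suc k)) (≤-trans short (∸-monoʳ-≤ n (n≤1+n (suc k))))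
  ... | inj₂ long with n∸d≡ ← trans (sym (m≥n⇒m⊓n≡n long)) arc≡ with a
  ...   | zero   = inj₁ (suc d , m≤o∸n⇒m+n≤o 2 (<⇒≤ b<n) (≤-trans (s≤s (s≤s z≤n)) (≤-reflexive (sym n∸d≡))) ,
                         ∣m-1+m∣≡1 d , arc-shortened long n∸d≡)
  ...   | suc a' = inj₂ (a' , ≤-trans (m≤m+n (suc a') d) (<⇒≤ b<n) ,
                         ∣1+m-m∣≡1 a' ,
                         trans (cong arc ∣1+a'+d-a'∣≡1+d) (arc-shortened long n∸d≡))
    where
    ∣1+a'+d-a'∣≡1+d : ∣ suc a' + d - a' ∣ ≡ suc d
    ∣1+a'+d-a'∣≡1+d = trans (cong (∣_- a' ∣) (sym (+-suc a' d))) (trans (∣-∣-comm (a' + suc d) a') (∣m-m+n∣≡n a' (suc d)))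

  CloserNeighbour : Fin n → Fin n → ℕ → Set
  CloserNeighbour a b k = Σ[ c ∈ Fin n ] ∣ toℕ b - toℕ c ∣ ≡ 1 × dist n a c ≡ k

  closer-neighbour-fromℕ : ∀ {a b k} → CloserNeighbourℕ (toℕ a) (toℕ b) k → CloserNeighbour a b k
  closer-neighbour-fromℕ {a} {b} {k} (c , c<n , b≈c , arc≡) =
    fromℕ< c<n ,
    subst (λ t → ∣ toℕ b - t ∣ ≡ 1) (sym (toℕ-fromℕ< c<n)) b≈c ,
    trans (dist≡arc a _) (subst (λ t → arc ∣ toℕ a - t ∣ ≡ k) (sym (toℕ-fromℕ< c<n)) arc≡)

  closer-neighbour : ∀ a b {k} → dist n a b ≡ suc (suc k) → CloserNeighbour a b (suc k) ⊎ CloserNeighbour b a (suc k)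
  closer-neighbour a b d≡ with <-cmp (toℕ a) (toℕ b)
  ... | tri< a<b _ _ = ⊎-map (closer-neighbour-fromℕ {a} {b}) (closer-neighbour-fromℕ {b} {a})
                         (closer-neighbourℕ a<b (toℕ<n b) (trans (sym (dist≡arc a b)) d≡))
  ... | tri≈ _ a≡b _ = contradiction (toℕ-injective a≡b) (dist>0⇒≢ (subst (0 <_) (sym d≡) (s≤s z≤n)))
  ... | tri> _ _ b<a = swap (⊎-map (closer-neighbour-fromℕ {b} {a}) (closer-neighbour-fromℕ {a} {b})
                         (closer-neighbourℕ b<a (toℕ<n a) (trans (sym (dist≡arc b a)) (trans (dist-comm b a) d≡))))

  InnerDistanceAtLeast : Matrix n → ℕ → Set
  InnerDistanceAtLeast L k = ∀ i j i' j' → Adjacent i j i' j' → k ≤ dist n (L i j) (L i' j')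

  Relabelling : Matrix n → ℕ → Set
  Relabelling L k = Σ[ π ∈ Permutation′ n ] HasInnerDistance n (applySym (π ⟨$⟩ʳ_) L) k

  relabel-towards : ∀ {L k} → InnerDistanceAtLeast L (suc (suc k)) → ∀ {i j i' j'} → Adjacent i j i' j' →
                    CloserNeighbour (L i j) (L i' j') (suc k) → Relabelling L (suc k)
  relabel-towards {L} {k} atLeast {i} {j} {i'} {j'} adj (c , b≈c , dist-a-c≡) =
    transpose b c , lowered , (i , j , i' , j' , adj , attained)
    where
    a = L i j
    b = L i' j'
    lowered : InnerDistanceAtLeast (applySym (PC.transpose b c) L) (suc k)
    lowered p q p' q' adj' = transpose-lowers (≤-reflexive b≈c) (L p q) (L p' q') (atLeast p q p' q' adj')
    a-fixed : PC.transpose b c a ≡ a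
    a-fixed = transpose-fixes (dist>0⇒≢ (≤-trans (s≤s z≤n) (atLeast i j i' j' adj)))
                              (dist>0⇒≢ (subst (0 <_) (sym dist-a-c≡) (s≤s z≤n)))
    attained : dist n (PC.transpose b c a) (PC.transpose b c b) ≡ suc k
    attained rewrite a-fixed | transpose-matchˡ b c = dist-a-c≡

  relabel-step : ∀ {L k} → HasInnerDistance n L (suc (suc k)) → Relabelling L (suc k)
  relabel-step {L} (atLeast , i , j , i' , j' , adj , d≡) with closer-neighbour (L i j) (L i' j') d≡
  ... | inj₁ closer = relabel-towards atLeast adj closer
  ... | inj₂ closer = relabel-towards atLeast (Adjacent-sym adj) closer

  relabel-below : ∀ {k k'} (L : Matrix n) → HasInnerDistance n L (suc (suc k)) → k' ≤ k → Relabelling L (suc k')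
  relabel-below L H k'≤k with m≤n⇒m<n∨m≡n k'≤k
  ... | inj₂ refl = relabel-step {L} H
  relabel-below {suc k} L H _ | inj₁ (s≤s k'≤k) =
    let π , H' = relabel-step {L} H
        ρ , H'' = relabel-below (applySym (π ⟨$⟩ʳ_) L) H' k'≤k
    in π ∘ₚ ρ , H''

  relabel-to : ∀ {k k'} (L : Matrix n) → HasInnerDistance n L k → 1 ≤ k' → k' < k → Relabelling L k'
  relabel-to L H (s≤s z≤n) (s≤s (s≤s k'≤k)) = relabel-below L H k'≤k

-- The order is n = m + q + 1 with q ∈ {m, m + 1}, so that m = ⌊(n − 1)/2⌋.
module ZigzagSquare (m q : ℕ) (m≤q : m ≤ q) (q≤1+m : q ≤ suc m) where

  n : ℕ
  n = suc (m + q)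

  open CyclicDistance n
  open Relabel n

  zigzag : ℕ → ℕ
  zigzag zero          = zero
  zigzag (suc zero)    = suc m
  zigzag (suc (suc x)) = suc (zigzag x)

  zigzag-even : ∀ t → zigzag (t + t) ≡ t
  zigzag-even zero    = refl
  zigzag-even (suc t) rewrite +-suc t t = cong suc (zigzag-even t)

  zigzag-odd : ∀ t → zigzag (suc (t + t)) ≡ suc m + t
  zigzag-odd zero    = cong suc (sym (+-identityʳ m))
  zigzag-odd (suc t) rewrite +-suc t t = cong suc (trans (zigzag-odd t) (sym (+-suc m t)))

  zigzag-step : ∀ x → ∣ zigzag x - zigzag (suc x) ∣ ≡ m ⊎ ∣ zigzag x - zigzag (suc x) ∣ ≡ suc m
  zigzag-step zero          = inj₂ refl
  zigzag-step (suc zero)    = inj₁ (∣-∣-identityʳ m)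
  zigzag-step (suc (suc x)) = zigzag-step x

  unzigzag : ℕ → ℕ
  unzigzag v with v ≤? m
  ... | yes _ = v + v
  ... | no _  = suc ((v ∸ suc m) + (v ∸ suc m))

  zigzag-< : ∀ {x} → x < n → zigzag x < n
  zigzag-< {x} x<n with even-or-odd x
  ... | t , inj₁ refl rewrite zigzag-even t = ≤-<-trans (m≤m+n t t) x<n
  ... | t , inj₂ refl rewrite zigzag-odd t = s≤s (+-monoʳ-< m (half-< (<-≤-trans (≤-pred x<n) (+-monoˡ-≤ q m≤q))))

  unzigzag-< : ∀ {v} → v < n → unzigzag v < n
  unzigzag-< {v} v<n with v ≤? m
  ... | yes v≤m = s≤s (+-mono-≤ v≤m (≤-trans v≤m m≤q))
  ... | no v≰m = s≤s (+-mono-≤-< (≤-pred (<-≤-trans t<q q≤1+m)) t<q)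
    where
    t<q : v ∸ suc m < q
    t<q = +-cancelˡ-< (suc m) (v ∸ suc m) q (subst (_< suc m + q) (sym (m+[n∸m]≡n (≰⇒> v≰m))) v<n)

  zigzag-unzigzag : ∀ v → zigzag (unzigzag v) ≡ v
  zigzag-unzigzag v with v ≤? m
  ... | yes _   = zigzag-even v
  ... | no v≰m  = trans (zigzag-odd (v ∸ suc m)) (m+[n∸m]≡n (≰⇒> v≰m))

  unzigzag-zigzag : ∀ {x} → x < n → unzigzag (zigzag x) ≡ x
  unzigzag-zigzag {x} x<n with even-or-odd x
  ... | t , inj₁ refl rewrite zigzag-even t with t ≤? m
  ...   | yes _   = refl
  ...   | no t≰m  = contradiction t≤m t≰m
    where
    t≤m : t ≤ m
    t≤m = ≤-pred (half-< (<-≤-trans x<n (s≤s (+-monoʳ-≤ m q≤1+m))))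
  unzigzag-zigzag {x} x<n | t , inj₂ refl rewrite zigzag-odd t with suc m + t ≤? m
  ...   | yes 1+m+t≤m = contradiction 1+m+t≤m (<⇒≱ (s≤s (m≤m+n m t)))
  ...   | no _ rewrite m+n∸m≡n (suc m) t = refl

  zigzagᶠ : Fin n → Fin n
  zigzagᶠ x = fromℕ< (zigzag-< (toℕ<n x))

  unzigzagᶠ : Fin n → Fin n
  unzigzagᶠ v = fromℕ< (unzigzag-< (toℕ<n v))

  toℕ-zigzagᶠ : ∀ x → toℕ (zigzagᶠ x) ≡ zigzag (toℕ x)
  toℕ-zigzagᶠ x = toℕ-fromℕ< (zigzag-< (toℕ<n x))

  toℕ-unzigzagᶠ : ∀ v → toℕ (unzigzagᶠ v) ≡ unzigzag (toℕ v)
  toℕ-unzigzagᶠ v = toℕ-fromℕ< (unzigzag-< (toℕ<n v))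

  zigzagₚ : Permutation′ n
  zigzagₚ = permutation zigzagᶠ unzigzagᶠ
    (λ v → toℕ-injective (trans (toℕ-zigzagᶠ (unzigzagᶠ v)) (trans (cong zigzag (toℕ-unzigzagᶠ v)) (zigzag-unzigzag (toℕ v)))))
    (λ x → toℕ-injective (trans (toℕ-unzigzagᶠ (zigzagᶠ x)) (trans (cong unzigzag (toℕ-zigzagᶠ x)) (unzigzag-zigzag (toℕ<n x)))))

  square : Matrix n
  square i j = zigzagᶠ i ⊕ zigzagᶠ j

  square-isLatinSquare : IsLatinSquare n square
  square-isLatinSquare = (λ i → ⟨$⟩ʳ-bijective (zigzagₚ ∘ₚ translationˡ (zigzagᶠ i))) ,
                         (λ j → ⟨$⟩ʳ-bijective (zigzagₚ ∘ₚ translationʳ (zigzagᶠ j)))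

  m≤n∸1+m : m ≤ n ∸ suc m
  m≤n∸1+m = subst (m ≤_) (sym (m+n∸m≡n (suc m) q)) m≤q

  m≤arc : ∀ {d} → d ≡ m ⊎ d ≡ suc m → m ≤ arc d
  m≤arc (inj₁ refl) = ⊓-glb ≤-refl (≤-trans m≤n∸1+m (∸-monoʳ-≤ n (n≤1+n m)))
  m≤arc (inj₂ refl) = ⊓-glb (n≤1+n m) m≤n∸1+m

  zigzagᶠ-adjacent : ∀ x y → toℕ y ≡ suc (toℕ x) ⊎ toℕ x ≡ suc (toℕ y) → m ≤ dist n (zigzagᶠ x) (zigzagᶠ y)
  zigzagᶠ-adjacent x y side rewrite dist≡arc (zigzagᶠ x) (zigzagᶠ y) | toℕ-zigzagᶠ x | toℕ-zigzagᶠ y with side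
  ... | inj₁ y≡1+x rewrite y≡1+x = m≤arc (zigzag-step (toℕ x))
  ... | inj₂ x≡1+y rewrite x≡1+y | ∣-∣-comm (zigzag (suc (toℕ y))) (zigzag (toℕ y)) = m≤arc (zigzag-step (toℕ y))

  square-atLeast : InnerDistanceAtLeast square m
  square-atLeast i j i' j' (inj₁ (refl , side))
    rewrite dist-translate (zigzagᶠ i) (zigzagᶠ j) (zigzagᶠ j') = zigzagᶠ-adjacent j j' side
  square-atLeast i j i' j' (inj₂ (refl , side))
    rewrite dist-translateʳ (zigzagᶠ j) (zigzagᶠ i) (zigzagᶠ i') = zigzagᶠ-adjacent i i' side

  square-hasInnerDistance : 1 ≤ m → HasInnerDistance n square m
  square-hasInnerDistance 1≤m = square-atLeast , (one , one , one , two , adjacent , attained)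
    where
    1<n : 1 < n
    1<n = s≤s (≤-trans 1≤m (m≤m+n m q))
    2<n : 2 < n
    2<n = s≤s (+-mono-≤ 1≤m (≤-trans 1≤m m≤q))
    one two : Fin n
    one = fromℕ< 1<n
    two = fromℕ< 2<n
    adjacent : Adjacent one one one two
    adjacent = inj₁ (refl , inj₁ (trans (toℕ-fromℕ< 2<n) (cong suc (sym (toℕ-fromℕ< 1<n)))))
    attained : dist n (zigzagᶠ one ⊕ zigzagᶠ one) (zigzagᶠ one ⊕ zigzagᶠ two) ≡ m
    attained rewrite dist-translate (zigzagᶠ one) (zigzagᶠ one) (zigzagᶠ two) | dist≡arc (zigzagᶠ one) (zigzagᶠ two)
                   | toℕ-zigzagᶠ one | toℕ-zigzagᶠ two | toℕ-fromℕ< 1<n | toℕ-fromℕ< 2<n | ∣-∣-identityʳ m =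
      m≤n⇒m⊓n≡m (≤-trans m≤n∸1+m (∸-monoʳ-≤ n (n≤1+n m)))

  latinSquare-withInnerDistance : 1 ≤ m → ∀ k → 1 ≤ k → k ≤ m → ∃[ L ] (IsLatinSquare n L × HasInnerDistance n L k)
  latinSquare-withInnerDistance 1≤m k 1≤k k≤m with m≤n⇒m<n∨m≡n k≤m
  ... | inj₂ refl = square , square-isLatinSquare , square-hasInnerDistance 1≤m
  ... | inj₁ k<m with π , H ← relabel-to square (square-hasInnerDistance 1≤m) 1≤k k<m =
    applySym (π ⟨$⟩ʳ_) square , applySym-isLatinSquare π square-isLatinSquare , H

mainTheorem11 : (n : ℕ) → (5 ≤ n) → .{{_ : NonZero n}} →
    ((k : ℕ) → 1 ≤ k → k ≤ (n ∸ 1) / 2 →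
      ∃[ L ] (IsLatinSquare n L × HasInnerDistance n L k)) ×
    ((L : Matrix n) → (k k' : ℕ) → IsLatinSquare n L → HasInnerDistance n L k →
      1 ≤ k' → k' < k →
      Σ (Fin n ⤖ Fin n) (λ σ → HasInnerDistance n (applySym (Bijection.to σ) L) k'))
mainTheorem11 (suc p) 5≤1+p with q , p≡m+q , m≤q , q≤1+m ← split-halves p = existence , relabelling
  where
  m = p / 2
  1≤m : 1 ≤ m
  1≤m = ≤-trans (s≤s z≤n) (/-monoˡ-≤ 2 (≤-pred 5≤1+p))
  existence : ∀ k → 1 ≤ k → k ≤ m → ∃[ L ] (IsLatinSquare (suc p) L × HasInnerDistance (suc p) L k)
  existence k 1≤k k≤m =
    subst (λ p → ∃[ L ] (IsLatinSquare (suc p) L × HasInnerDistance (suc p) L k)) (sym p≡m+q)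
      (ZigzagSquare.latinSquare-withInnerDistance m q m≤q q≤1+m 1≤m k 1≤k k≤m)
  relabelling : ∀ L k k' → IsLatinSquare (suc p) L → HasInnerDistance (suc p) L k → 1 ≤ k' → k' < k →
                Σ (Fin (suc p) ⤖ Fin (suc p)) (λ σ → HasInnerDistance (suc p) (applySym (Bijection.to σ) L) k')
  relabelling L k k' _ H 1≤k' k'<k with π , H' ← Relabel.relabel-to (suc p) L H 1≤k' k'<k = ↔⇒⤖ π , H'
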